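{- Let $T$ be a tree and let $v$ be a leaf of $T$. Then $T$ has a consistent range-relaxed graceful labeling $f$ with $f(v)=0$.
   Context: A labeling of a tree $T$ is an injective map $f$ from the vertices of $T$ to the non-negative integers; the induced label of an edge $xy$ is $|f(x)-f(y)|$. The labeling is range-relaxed graceful if the induced edge labels are pairwise distinct. Writing $V_f$ for the set of vertex labels and $E_f$ for the set of induced edge labels, a range-relaxed graceful labeling is consistent if $V_f=E_f\cup\{0\}$. -}

module Defs where

open import Data.Nat using (ℕ; _≤_; ∣_-_∣)
open import Data.Fin using (Fin)
open import Data.List using (List; []; _∷_; _∷ʳ_; length)
open import Data.List.Relation.Unary.Unique.Propositional using (Unique)
open import Data.List.Relation.Unary.Linked using (Linked)
open import Data.Product using (Σ; ∃; _×_; _,_)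
open import Data.Sum using (_⊎_)
open import Relation.Nullary using (¬_)
open import Relation.Binary.PropositionalEquality using (_≡_)
open import Function.Definitions using (Injective)

record Graph (n : ℕ) : Set₁ where
  field
    Adj   : Fin n → Fin n → Set
    irrefl : ∀ x → ¬ Adj x x
    sym   : ∀ {x y} → Adj x y → Adj y x
open Graph public

data Walk {n : ℕ} (G : Graph n) : Fin n → Fin n → Set where
  here : ∀ {x} → Walk G x x
  step : ∀ {x y z} → Adj G x y → Walk G y z → Walk G x z

Connected : ∀ {n} → Graph n → Set
Connected G = ∀ x y → Walk G x y

-- a cycle: distinct vertices x, z₁ … z_k, y (k ≥ 1, so at least 3 vertices)
-- with consecutive vertices adjacent and y adjacent to x
HasCycle : ∀ {n} → Graph n → Set
HasCycle {n} G =
  Σ (Fin n) λ x → Σ (Fin n) λ y → Σ (List (Fin n)) λ zs →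
    (1 ≤ length zs) × Unique (x ∷ (zs ∷ʳ y)) × Linked (Adj G) (x ∷ (zs ∷ʳ y)) × Adj G y x

Acyclic : ∀ {n} → Graph n → Set
Acyclic G = ¬ HasCycle G

-- a tree: a connected acyclic graph (vertex set nonempty whenever a leaf exists)
IsTree : ∀ {n} → Graph n → Set
IsTree G = Connected G × Acyclic G

IsLeaf : ∀ {n} → Graph n → Fin n → Set
IsLeaf {n} G v = Σ (Fin n) λ u → Adj G v u × (∀ w → Adj G v w → w ≡ u)

edgeLabel : ∀ {n} → (Fin n → ℕ) → Fin n → Fin n → ℕ
edgeLabel f x y = ∣ f x - f y ∣

RangeRelaxedGraceful : ∀ {n} → Graph n → (Fin n → ℕ) → Set
RangeRelaxedGraceful {n} G f =
  Injective _≡_ _≡_ f ×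
  (∀ x y u w → Adj G x y → Adj G u w → edgeLabel f x y ≡ edgeLabel f u w →
     (x ≡ u × y ≡ w) ⊎ (x ≡ w × y ≡ u))

InVf : ∀ {n} → (Fin n → ℕ) → ℕ → Set
InVf {n} f k = Σ (Fin n) λ x → f x ≡ k

InEf : ∀ {n} → Graph n → (Fin n → ℕ) → ℕ → Set
InEf {n} G f k = Σ (Fin n) λ x → Σ (Fin n) λ y → Adj G x y × edgeLabel f x y ≡ k

ConsistentRRG : ∀ {n} → Graph n → (Fin n → ℕ) → Set
ConsistentRRG G f =
  RangeRelaxedGraceful G f ×
  (∀ k → InVf f k → InEf G f k ⊎ k ≡ 0) ×
  (∀ k → InEf G f k ⊎ k ≡ 0 → InVf f k)

module Submission where

-- A tree T with a distinguished vertex v has a consistent range-relaxed graceful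
-- labelling f with f(v) = 0; the construction does not use that v is a leaf.
--
-- Root T at v. Every non-root vertex x has a parent p(x), and the edges of T are
-- exactly the pairs {x, p(x)}. Among the children of a vertex u, ordered by rank
-- 0, …, k-1, pair the child of rank j with its "mirror" of rank k-1-j; let the
-- partner of x be its mirror, except for children of v, which are their own partner.
-- Partnering is an involution of the non-root vertices. A non-root x of depth d
-- gets the label f(x) = K^(D-d) · (2·a(x) + 1), where D bounds all depths,
-- K = 2·(2n+1) and the address a(x) records, in base 2n+1, the digits of the
-- vertices on the path from x up to v; the digits are chosen so that mirror
-- siblings have digits summing to 2n. This makes f injective and gives
-- f(p(x)) = f(x) + f(mirror x), so the edge {x, p(x)} has label f(partner x).
-- Hence edge labels are distinct and they are exactly the non-zero vertex labels.

open import Defs hiding (sym)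
open import Data.Nat using (ℕ; zero; suc; _+_; _*_; _∸_; _^_; _≤_; _<_; s≤s; z≤n; ∣_-_∣; NonZero; ≢-nonZero⁻¹)
open import Data.Nat.Properties hiding (_≟_)
open import Data.Nat.DivMod using (_%_; [m+kn]%n≡m%n; m<n⇒m%n≡m)
open import Data.Nat.Tactic.RingSolver using (solve-∀)
open import Data.Fin using (Fin; _≟_; toℕ; opposite)
open import Data.Fin.Properties using (toℕ<n; toℕ-injective; opposite-prop; opposite-involutive)
open import Data.List using (List; []; _∷_; _∷ʳ_; length; lookup; head; filter; allFin)
open import Data.List.Properties using (∷-injectiveʳ; length-filter; length-tabulate)
open import Data.List.Extrema.Nat using (argmax; f[xs]≤f[argmax])
open import Data.List.Membership.Propositional using (_∈_; _∉_)
open import Data.List.Membership.Propositional.Properties using (∈-allFin; ∈-filter⁺; ∈-filter⁻)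
import Data.List.Membership.Setoid.Properties as SetoidMembership
open import Data.List.Relation.Binary.Subset.Propositional using (_⊆_)
open import Data.List.Relation.Unary.Any using (here; there; index)
open import Data.List.Relation.Unary.Any.Properties using (lookup-index)
open import Data.List.Relation.Unary.All as All using (All; []; _∷_)
open import Data.List.Relation.Unary.All.Properties using (¬Any⇒All¬; All¬⇒¬Any)
open import Data.List.Relation.Unary.AllPairs using ([]; _∷_)
open import Data.List.Relation.Unary.Linked using (Linked; [-]; _∷_)
open import Data.List.Relation.Unary.Unique.Propositional using (Unique)
open import Data.List.Relation.Unary.Unique.Propositional.Properties using (allFin⁺; filter⁺)
open import Data.Maybe using (fromMaybe)
open import Data.Product using (Σ; _×_; _,_; proj₁; proj₂)
open import Data.Sum using (_⊎_; inj₁; inj₂)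
open import Data.Empty using (⊥; ⊥-elim)
open import Function using (_∘_)
open import Relation.Nullary using (¬_; Dec; yes; no)
open import Relation.Nullary.Negation using (contradiction)
open import Relation.Nullary.Decidable using (¬?; _×-dec_)
open import Relation.Unary using (Decidable)
open import Relation.Binary.Definitions using (DecidableEquality)
open import Relation.Binary.PropositionalEquality
  using (_≡_; _≢_; refl; sym; trans; cong; cong₂; subst; setoid; module ≡-Reasoning)
open import Axiom.UniquenessOfIdentityProofs using (module Decidable⇒UIP)

base-digits-unique : ∀ B {a b c d} .{{_ : NonZero B}} → a < B → c < B → a + b * B ≡ c + d * B → a ≡ c × b ≡ d
base-digits-unique B {a} {b} {c} {d} a<B c<B eq =
  a≡c , *-cancelʳ-≡ b d B (+-cancelˡ-≡ a _ _ (trans eq (cong (_+ d * B) (sym a≡c))))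
  where
  open ≡-Reasoning
  a≡c : a ≡ c
  a≡c = begin
    a                 ≡⟨ sym (m<n⇒m%n≡m a<B) ⟩
    a % B             ≡⟨ sym ([m+kn]%n≡m%n a b B) ⟩
    (a + b * B) % B   ≡⟨ cong (_% B) eq ⟩
    (c + d * B) % B   ≡⟨ [m+kn]%n≡m%n c d B ⟩
    c % B             ≡⟨ m<n⇒m%n≡m c<B ⟩
    c                 ∎

module ScaledOdd (m : ℕ) where
  K : ℕ
  K = 2 * suc m

  scaled-odd-nonzero : ∀ e q → K ^ e * suc (2 * q) ≢ 0
  scaled-odd-nonzero e q = ≢-nonZero⁻¹ _ {{m*n≢0 _ _ {{m^n≢0 K e}}}}

  power-suc : ∀ e r → K ^ suc e * r ≡ K * (K ^ e * r)
  power-suc e r = *-assoc K (K ^ e) r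

  scaled-odd-injective : ∀ {e e′ q q′} → K ^ e * suc (2 * q) ≡ K ^ e′ * suc (2 * q′) → e ≡ e′ × q ≡ q′
  scaled-odd-injective {zero} {zero} {q} {q′} eq =
    refl , *-cancelˡ-≡ q q′ 2 (suc-injective (trans (sym (*-identityˡ _)) (trans eq (*-identityˡ _))))
  scaled-odd-injective {zero} {suc e′} {q} {q′} eq = contradiction even≡odd (even≢odd (suc m * r) q)
    where
    r = K ^ e′ * suc (2 * q′)
    even≡odd : 2 * (suc m * r) ≡ suc (2 * q)
    even≡odd = trans (sym (*-assoc 2 (suc m) r)) (trans (sym (power-suc e′ _)) (trans (sym eq) (*-identityˡ _)))
  scaled-odd-injective {suc e} {zero} eq with scaled-odd-injective (sym eq)
  ... | e′≡e , q′≡q = sym e′≡e , sym q′≡q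
  scaled-odd-injective {suc e} {suc e′} {q} {q′} eq
    with scaled-odd-injective {e} {e′} {q} {q′}
           (*-cancelˡ-≡ _ _ K (trans (sym (power-suc e _)) (trans eq (power-suc e′ _))))
  ... | e≡e′ , q≡q′ = cong suc e≡e′ , q≡q′

-- The identity behind f(parent) = f(x) + f(mirror x): with H = 2m+1, two addresses
-- a + qH and b + qH whose digits sum to 2m give odd parts adding up to 2H(2q+1).
odd-pair : ∀ m q a b → a + b ≡ 2 * m →
           suc (2 * (a + q * suc (2 * m))) + suc (2 * (b + q * suc (2 * m))) ≡ 2 * suc (2 * m) * suc (2 * q)
odd-pair m q a b a+b≡2m = begin
  suc (2 * (a + q * H)) + suc (2 * (b + q * H))  ≡⟨ regroup a b (q * H) ⟩
  2 * (a + b) + suc (suc (4 * (q * H)))          ≡⟨ cong (λ s → 2 * s + suc (suc (4 * (q * H)))) a+b≡2m ⟩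
  2 * (2 * m) + suc (suc (4 * (q * H)))          ≡⟨ factor m q ⟩
  2 * H * suc (2 * q)                            ∎
  where
  open ≡-Reasoning
  H = suc (2 * m)
  regroup : ∀ a b c → suc (2 * (a + c)) + suc (2 * (b + c)) ≡ 2 * (a + b) + suc (suc (4 * c))
  regroup = solve-∀
  factor : ∀ m q → 2 * (2 * m) + suc (suc (4 * (q * suc (2 * m)))) ≡ 2 * suc (2 * m) * suc (2 * q)
  factor = solve-∀

-- Rank and mirror image of an element of a list: the element of rank k-1-j is the
-- mirror of the element of rank j (for elements not in the list, rank is 0 and the
-- mirror is the element itself).
module ListMirror {A : Set} (_≟_ : DecidableEquality A) where
  open import Data.List.Membership.DecPropositional _≟_ using (_∈?_)

  rank : List A → A → ℕ
  rank xs x with x ∈? xs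
  ... | yes x∈xs = toℕ (index x∈xs)
  ... | no _     = 0

  mirror : List A → A → A
  mirror xs x with x ∈? xs
  ... | yes x∈xs = lookup xs (opposite (index x∈xs))
  ... | no _     = x

  -- in a list without repetitions the position of an element does not depend on the
  -- membership proof, so rank and mirror can be computed from any such proof
  index-irrelevant : ∀ {x xs} → Unique xs → (p q : x ∈ xs) → index p ≡ index q
  index-irrelevant u p q =
    cong index (SetoidMembership.unique⇒irrelevant (setoid A) (Decidable⇒UIP.≡-irrelevant _≟_) u p q)

  lookup∈ : ∀ xs (i : Fin (length xs)) → lookup xs i ∈ xs
  lookup∈ = SetoidMembership.∈-lookup (setoid A)

  index-lookup∈ : ∀ xs (i : Fin (length xs)) → index (lookup∈ xs i) ≡ i
  index-lookup∈ (x ∷ xs) Fin.zero    = refl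
  index-lookup∈ (x ∷ xs) (Fin.suc i) = cong Fin.suc (index-lookup∈ xs i)

  rank-index : ∀ {x xs} → Unique xs → (p : x ∈ xs) → rank xs x ≡ toℕ (index p)
  rank-index {x} {xs} u p with x ∈? xs
  ... | yes q = cong toℕ (index-irrelevant u q p)
  ... | no x∉xs = contradiction p x∉xs

  mirror-index : ∀ {x xs} → Unique xs → (p : x ∈ xs) → mirror xs x ≡ lookup xs (opposite (index p))
  mirror-index {x} {xs} u p with x ∈? xs
  ... | yes q = cong (λ i → lookup xs (opposite i)) (index-irrelevant u q p)
  ... | no x∉xs = contradiction p x∉xs

  mirror-∉ : ∀ {x xs} → ¬ x ∈ xs → mirror xs x ≡ x
  mirror-∉ {x} {xs} x∉xs with x ∈? xs
  ... | yes p = contradiction p x∉xs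
  ... | no _ = refl

  mirror-∈ : ∀ {x xs} → x ∈ xs → mirror xs x ∈ xs
  mirror-∈ {x} {xs} p with x ∈? xs
  ... | yes q = lookup∈ xs _
  ... | no x∉xs = contradiction p x∉xs

  mirror-involutive : ∀ {xs} → Unique xs → ∀ x → mirror xs (mirror xs x) ≡ x
  mirror-involutive {xs} u x with x ∈? xs
  ... | no x∉xs = mirror-∉ x∉xs
  ... | yes p = begin
    mirror xs (lookup xs (opposite (index p)))        ≡⟨ mirror-index u (lookup∈ xs _) ⟩
    lookup xs (opposite (index (lookup∈ xs _)))          ≡⟨ cong (λ i → lookup xs (opposite i)) (index-lookup∈ xs _) ⟩
    lookup xs (opposite (opposite (index p)))          ≡⟨ cong (lookup xs) (opposite-involutive (index p)) ⟩
    lookup xs (index p)                                ≡⟨ sym (lookup-index p) ⟩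
    x                                                  ∎
    where open ≡-Reasoning

  rank-< : ∀ {x xs} → Unique xs → x ∈ xs → rank xs x < length xs
  rank-< {x} {xs} u p rewrite rank-index u p = toℕ<n (index p)

  rank-mirror : ∀ {x xs} → Unique xs → x ∈ xs → suc (rank xs x + rank xs (mirror xs x)) ≡ length xs
  rank-mirror {x} {xs} u p = begin
    suc (rank xs x + rank xs (mirror xs x))                 ≡⟨ cong₂ (λ r s → suc (r + s)) (rank-index u p) rank-partner ⟩
    suc (toℕ i + toℕ (opposite i))                          ≡⟨ cong (λ s → suc (toℕ i + s)) (opposite-prop i) ⟩
    suc (toℕ i + (length xs ∸ suc (toℕ i)))                ≡⟨ m+[n∸m]≡n (toℕ<n i) ⟩
    length xs                                               ∎
    where
    open ≡-Reasoning
    i = index p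
    rank-partner : rank xs (mirror xs x) ≡ toℕ (opposite i)
    rank-partner = begin
      rank xs (mirror xs x)                     ≡⟨ cong (rank xs) (mirror-index u p) ⟩
      rank xs (lookup xs (opposite i))          ≡⟨ rank-index u (lookup∈ xs _) ⟩
      toℕ (index (lookup∈ xs (opposite i)))    ≡⟨ cong toℕ (index-lookup∈ xs _) ⟩
      toℕ (opposite i)                          ∎

  rank-injective : ∀ {x y xs} → Unique xs → x ∈ xs → y ∈ xs → rank xs x ≡ rank xs y → x ≡ y
  rank-injective u p q eq = SetoidMembership.index-injective (setoid A) p q
    (toℕ-injective (trans (sym (rank-index u p)) (trans eq (rank-index u q))))

module WalkProperties {n : ℕ} (G : Graph n) where
  open import Data.List.Membership.DecPropositional (_≟_ {n}) using (_∈?_)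

  later : ∀ {x y} → Walk G x y → List (Fin n)
  later here                = []
  later (step {y = y} _ w)  = y ∷ later w

  vertices : ∀ {x y} → Walk G x y → List (Fin n)
  vertices {x} w = x ∷ later w

  earlier : ∀ {x y} → Walk G x y → List (Fin n)
  earlier here                = []
  earlier (step {x = x} _ w)  = x ∷ earlier w

  vertices-earlier : ∀ {x y} (w : Walk G x y) → vertices w ≡ earlier w ∷ʳ y
  vertices-earlier here                = refl
  vertices-earlier (step {x = x} _ w)  = cong (x ∷_) (vertices-earlier w)

  IsPath : ∀ {x y} → Walk G x y → Set
  IsPath w = Unique (vertices w)

  end∈ : ∀ {x y} (w : Walk G x y) → y ∈ vertices w
  end∈ here        = here refl
  end∈ (step _ w)  = there (end∈ w)

  vertices-linked : ∀ {x y} (w : Walk G x y) → Linked (Adj G) (vertices w)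
  vertices-linked here                = [-]
  vertices-linked (step a here)       = a ∷ [-]
  vertices-linked (step a (step b w)) = a ∷ vertices-linked (step b w)

  _++ʷ_ : ∀ {x y z} → Walk G x y → Walk G y z → Walk G x z
  here     ++ʷ w′ = w′
  step a w ++ʷ w′ = step a (w ++ʷ w′)

  reverseʷ : ∀ {x y} → Walk G x y → Walk G y x
  reverseʷ here       = here
  reverseʷ (step a w) = reverseʷ w ++ʷ step (Graph.sym G a) here

  ∈-++ʷ : ∀ {x y z t} (w : Walk G x y) (w′ : Walk G y z) →
          t ∈ vertices (w ++ʷ w′) → t ∈ vertices w ⊎ t ∈ vertices w′
  ∈-++ʷ here       w′ t∈        = inj₂ t∈
  ∈-++ʷ (step a w) w′ (here e)  = inj₁ (here e)
  ∈-++ʷ (step a w) w′ (there t∈) with ∈-++ʷ w w′ t∈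
  ... | inj₁ t∈w  = inj₁ (there t∈w)
  ... | inj₂ t∈w′ = inj₂ t∈w′

  ∈-reverseʷ : ∀ {x y t} (w : Walk G x y) → t ∈ vertices (reverseʷ w) → t ∈ vertices w
  ∈-reverseʷ here t∈ = t∈
  ∈-reverseʷ (step a w) t∈ with ∈-++ʷ (reverseʷ w) (step (Graph.sym G a) here) t∈
  ... | inj₁ t∈w                 = there (∈-reverseʷ w t∈w)
  ... | inj₂ (here refl)         = there (here refl)
  ... | inj₂ (there (here refl)) = here refl

  suffix : ∀ {x y z} (w : Walk G x z) → y ∈ vertices w → Walk G y z
  suffix w          (here refl) = w
  suffix (step _ w) (there y∈)  = suffix w y∈

  suffix-⊆ : ∀ {x y z} (w : Walk G x z) (y∈ : y ∈ vertices w) → vertices (suffix w y∈) ⊆ vertices w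
  suffix-⊆ w          (here refl) t∈ = t∈
  suffix-⊆ (step _ w) (there y∈)  t∈ = there (suffix-⊆ w y∈ t∈)

  suffix-isPath : ∀ {x y z} (w : Walk G x z) (y∈ : y ∈ vertices w) → IsPath w → IsPath (suffix w y∈)
  suffix-isPath w          (here refl) p       = p
  suffix-isPath (step _ w) (there y∈)  (_ ∷ p) = suffix-isPath w y∈ p

  toPath : ∀ {x y} (w : Walk G x y) → Σ (Walk G x y) λ w′ → IsPath w′ × vertices w′ ⊆ vertices w
  toPath here = here , [] ∷ [] , (λ t∈ → t∈)
  toPath (step {x = x} a w) with toPath w
  ... | w′ , p , w′⊆w with x ∈? vertices w′
  ...   | yes x∈ = suffix w′ x∈ , suffix-isPath w′ x∈ p , there ∘ w′⊆w ∘ suffix-⊆ w′ x∈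
  ...   | no x∉  = step a w′ , ¬Any⇒All¬ _ x∉ ∷ p , step⊆
    where
    step⊆ : vertices (step a w′) ⊆ vertices (step a w)
    step⊆ (here e)   = here e
    step⊆ (there t∈) = there (w′⊆w t∈)

  -- in an acyclic graph, two distinct neighbours s, t of a are not joined by a walk
  -- avoiding a: shortened to a path, it would close a cycle through a
  no-bypass : Acyclic G → ∀ {a s t} → Adj G a s → Adj G a t → s ≢ t →
              (w : Walk G s t) → a ∉ vertices w → ⊥
  no-bypass acyclic {a} {s} {t} a~s a~t s≢t w a∉w with toPath w
  ... | here , _ , _ = s≢t refl
  ... | p@(step _ _) , p-path , p⊆w =
    acyclic (a , t , earlier p , s≤s z≤n , cycle-unique , cycle-linked , Graph.sym G a~t)
    where
    cycle-unique : Unique (a ∷ (earlier p ∷ʳ t))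
    cycle-unique = subst (λ l → Unique (a ∷ l)) (vertices-earlier p) (¬Any⇒All¬ _ (a∉w ∘ p⊆w) ∷ p-path)
    cycle-linked : Linked (Adj G) (a ∷ (earlier p ∷ʳ t))
    cycle-linked = subst (λ l → Linked (Adj G) (a ∷ l)) (vertices-earlier p) (a~s ∷ vertices-linked p)

  -- in an acyclic graph two paths with the same ends visit the same vertices: if their
  -- second vertices differed, they would be joined by a walk avoiding the first one
  paths-unique : Acyclic G → ∀ {x y} (w w′ : Walk G x y) → IsPath w → IsPath w′ → vertices w ≡ vertices w′
  paths-unique acyclic here here _ _ = refl
  paths-unique acyclic here (step _ w′) _ (x∉ ∷ _) = ⊥-elim (All¬⇒¬Any x∉ (end∈ w′))
  paths-unique acyclic (step _ w) here (x∉ ∷ _) _ = ⊥-elim (All¬⇒¬Any x∉ (end∈ w))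
  paths-unique acyclic {x} (step {y = s} a w) (step {y = t} b w′) (x∉w ∷ p) (x∉w′ ∷ p′) with s ≟ t
  ... | yes refl = cong (x ∷_) (paths-unique acyclic w w′ p p′)
  ... | no s≢t   = ⊥-elim (no-bypass acyclic a b s≢t (w ++ʷ reverseʷ w′) x∉)
    where
    x∉ : x ∉ vertices (w ++ʷ reverseʷ w′)
    x∉ x∈ with ∈-++ʷ w (reverseʷ w′) x∈
    ... | inj₁ x∈w  = All¬⇒¬Any x∉w x∈w
    ... | inj₂ x∈w′ = All¬⇒¬Any x∉w′ (∈-reverseʷ w′ x∈w′)

-- This is all the labelling below uses about the tree.
record Rooting {n : ℕ} (T : Graph n) (v : Fin n) : Set where
  field
    parent          : Fin n → Fin n
    depth           : Fin n → ℕ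
    depth-root      : depth v ≡ 0
    depth-parent    : ∀ {x} → x ≢ v → depth x ≡ suc (depth (parent x))
    parent-adjacent : ∀ {x} → x ≢ v → Adj T x (parent x)
    edge-to-parent  : ∀ {x y} → Adj T x y → (x ≢ v × parent x ≡ y) ⊎ (y ≢ v × parent y ≡ x)

module TreeRooting {n : ℕ} (T : Graph n) (tree : IsTree T) (v : Fin n) where
  open WalkProperties T
  open import Data.List.Membership.DecPropositional (_≟_ {n}) using (_∈?_)

  pathToRoot : ∀ x → Walk T x v
  pathToRoot x = proj₁ (toPath (proj₁ tree x v))

  pathToRoot-isPath : ∀ x → IsPath (pathToRoot x)
  pathToRoot-isPath x = proj₁ (proj₂ (toPath (proj₁ tree x v)))

  ancestors : Fin n → List (Fin n)
  ancestors x = later (pathToRoot x)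

  parent : Fin n → Fin n
  parent x = fromMaybe x (head (ancestors x))

  depth : Fin n → ℕ
  depth x = length (ancestors x)

  ancestors-unique : ∀ {x} (w : Walk T x v) → IsPath w → later w ≡ ancestors x
  ancestors-unique w w-path =
    ∷-injectiveʳ (paths-unique (proj₂ tree) w (pathToRoot _) w-path (pathToRoot-isPath _))

  ancestors-root : ancestors v ≡ []
  ancestors-root = sym (ancestors-unique here ([] ∷ []))

  ancestors-nonroot-path : ∀ {x} (w : Walk T x v) → IsPath w → x ≢ v →
                           let y = fromMaybe x (head (later w)) in Adj T x y × later w ≡ y ∷ ancestors y
  ancestors-nonroot-path here       _            x≢v = ⊥-elim (x≢v refl)
  ancestors-nonroot-path (step a w) (_ ∷ w-path) _   = a , cong (_ ∷_) (ancestors-unique w w-path)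

  ancestors-nonroot : ∀ {x} → x ≢ v → Adj T x (parent x) × ancestors x ≡ parent x ∷ ancestors (parent x)
  ancestors-nonroot {x} = ancestors-nonroot-path (pathToRoot x) (pathToRoot-isPath x)

  parent-via : ∀ {y z} → Adj T y z → (w : Walk T z v) → IsPath w → y ∉ vertices w → y ≢ v × parent y ≡ z
  parent-via {y} {z} y~z w w-path y∉w = y≢v , cong (fromMaybe y ∘ head) ancestors-y
    where
    ancestors-y : ancestors y ≡ z ∷ ancestors z
    ancestors-y = trans (sym (ancestors-unique (step y~z w) (¬Any⇒All¬ _ y∉w ∷ w-path)))
                        (cong (z ∷_) (ancestors-unique w w-path))
    y≢v : y ≢ v
    y≢v refl with trans (sym ancestors-root) ancestors-y
    ... | ()

  -- an edge {x, y}: either x is off the path from y (so y is the parent of x), or x is on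
  -- it, hence x is the parent of y since the path from x to the root avoids y
  edge-to-parent : ∀ {x y} → Adj T x y → (x ≢ v × parent x ≡ y) ⊎ (y ≢ v × parent y ≡ x)
  edge-to-parent {x} {y} x~y with x ∈? vertices (pathToRoot y)
  ... | no x∉                  = inj₁ (parent-via x~y (pathToRoot y) (pathToRoot-isPath y) x∉)
  ... | yes (here refl)        = ⊥-elim (irrefl T x x~y)
  ... | yes (there x∈ancestors) = inj₂ (parent-via (Graph.sym T x~y) (suffix w x∈w)
                                      (suffix-isPath w x∈w (pathToRoot-isPath _)) (y∉w ∘ suffix-⊆ w x∈w))
    where
    y≢v : y ≢ v
    y≢v refl with subst (x ∈_) ancestors-root x∈ancestors
    ... | ()
    w = pathToRoot (parent y)
    ancestors-y : ancestors y ≡ vertices w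
    ancestors-y = proj₂ (ancestors-nonroot y≢v)
    x∈w : x ∈ vertices w
    x∈w = subst (x ∈_) ancestors-y x∈ancestors
    y∉w : y ∉ vertices w
    y∉w with pathToRoot-isPath y
    ... | y∉ancestors ∷ _ = All¬⇒¬Any (subst (All (y ≢_)) ancestors-y y∉ancestors)

  rooting : Rooting T v
  rooting = record
    { parent          = parent
    ; depth           = depth
    ; depth-root      = cong length ancestors-root
    ; depth-parent    = cong length ∘ proj₂ ∘ ancestors-nonroot
    ; parent-adjacent = proj₁ ∘ ancestors-nonroot
    ; edge-to-parent  = edge-to-parent
    }

module Labelling {n : ℕ} (T : Graph n) (v : Fin n) (R : Rooting T v) where
  open Rooting R
  open ListMirror (_≟_ {n})

  root-of-depth-zero : ∀ {x} → depth x ≡ 0 → x ≡ v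
  root-of-depth-zero {x} depth≡0 with x ≟ v
  ... | yes x≡v = x≡v
  ... | no x≢v  = contradiction (trans (sym (depth-parent x≢v)) depth≡0) λ ()

  nonroot-of-depth-suc : ∀ {x t} → depth x ≡ suc t → x ≢ v
  nonroot-of-depth-suc depth≡suc refl = contradiction (trans (sym depth-root) depth≡suc) λ ()

  ChildOf : Fin n → Fin n → Set
  ChildOf u y = y ≢ v × parent y ≡ u

  childOf? : ∀ u → Decidable (ChildOf u)
  childOf? u y = ¬? (y ≟ v) ×-dec (parent y ≟ u)

  children : Fin n → List (Fin n)
  children u = filter (childOf? u) (allFin n)

  children-unique : ∀ u → Unique (children u)
  children-unique u = filter⁺ (childOf? u) (allFin⁺ n)

  ∈-children : ∀ {x} → x ≢ v → x ∈ children (parent x)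
  ∈-children {x} x≢v = ∈-filter⁺ (childOf? (parent x)) (∈-allFin x) (x≢v , refl)

  children⁻ : ∀ {u y} → y ∈ children u → ChildOf u y
  children⁻ {u} y∈ = proj₂ (∈-filter⁻ (childOf? u) {xs = allFin n} y∈)

  children-length : ∀ u → length (children u) ≤ n
  children-length u = ≤-trans (length-filter (childOf? u) (allFin n)) (≤-reflexive (length-tabulate (λ i → i)))

  siblingCount : Fin n → ℕ
  siblingCount x = length (children (parent x))

  siblingRank : Fin n → ℕ
  siblingRank x = rank (children (parent x)) x

  mirrorSibling : Fin n → Fin n
  mirrorSibling x = mirror (children (parent x)) x

  mirrorSibling-sibling : ∀ {x} → x ≢ v → ChildOf (parent x) (mirrorSibling x)
  mirrorSibling-sibling x≢v = children⁻ (mirror-∈ (∈-children x≢v))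

  siblings-of-mirror : ∀ {x} → x ≢ v → children (parent (mirrorSibling x)) ≡ children (parent x)
  siblings-of-mirror x≢v = cong children (proj₂ (mirrorSibling-sibling x≢v))

  mirrorSibling-involutive : ∀ {x} → x ≢ v → mirrorSibling (mirrorSibling x) ≡ x
  mirrorSibling-involutive {x} x≢v = trans
    (cong (λ cs → mirror cs (mirrorSibling x)) (siblings-of-mirror x≢v))
    (mirror-involutive (children-unique (parent x)) x)

  siblingRank-< : ∀ {x} → x ≢ v → siblingRank x < siblingCount x
  siblingRank-< x≢v = rank-< (children-unique _) (∈-children x≢v)

  siblingRank-mirror : ∀ {x} → x ≢ v → suc (siblingRank x + siblingRank (mirrorSibling x)) ≡ siblingCount x
  siblingRank-mirror {x} x≢v = trans
    (cong (λ cs → suc (siblingRank x + rank cs (mirrorSibling x))) (siblings-of-mirror x≢v))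
    (rank-mirror (children-unique (parent x)) (∈-children x≢v))

  siblingRank-injective : ∀ {x y} → x ≢ v → y ≢ v → parent x ≡ parent y → siblingRank x ≡ siblingRank y → x ≡ y
  siblingRank-injective {x} {y} x≢v y≢v px≡py rx≡ry = rank-injective (children-unique (parent x)) (∈-children x≢v)
    (subst (y ∈_) (cong children (sym px≡py)) (∈-children y≢v))
    (trans rx≡ry (cong (λ cs → rank cs y) (cong children (sym px≡py))))

  -- the vertex whose label will be the label of the edge {x, parent x}: x itself when
  -- the parent is the root (label 0), the mirror sibling otherwise
  partner : Fin n → Fin n
  partner x with parent x ≟ v
  ... | yes _ = x
  ... | no _  = mirrorSibling x

  partner-of-root-child : ∀ {x} → parent x ≡ v → partner x ≡ x
  partner-of-root-child {x} px≡v with parent x ≟ v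
  ... | yes _    = refl
  ... | no px≢v = contradiction px≡v px≢v

  partner-of-inner : ∀ {x} → parent x ≢ v → partner x ≡ mirrorSibling x
  partner-of-inner {x} px≢v with parent x ≟ v
  ... | yes px≡v = contradiction px≡v px≢v
  ... | no _     = refl

  partner-sibling : ∀ {x} → x ≢ v → ChildOf (parent x) (partner x)
  partner-sibling {x} x≢v with parent x ≟ v
  ... | yes _ = x≢v , refl
  ... | no _  = mirrorSibling-sibling x≢v

  -- partnering is an involution of the non-root vertices, so edges and non-root vertices
  -- are in bijection through x ↦ partner x
  partner-involutive : ∀ {x} → x ≢ v → partner (partner x) ≡ x
  partner-involutive {x} x≢v with parent x ≟ v
  ... | yes px≡v = partner-of-root-child px≡v
  ... | no px≢v  = trans (partner-of-inner (subst (_≢ v) (sym (proj₂ (mirrorSibling-sibling x≢v))) px≢v))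
                         (mirrorSibling-involutive x≢v)

  partner-injective : ∀ {x y} → x ≢ v → y ≢ v → partner x ≡ partner y → x ≡ y
  partner-injective x≢v y≢v eq =
    trans (sym (partner-involutive x≢v)) (trans (cong partner eq) (partner-involutive y≢v))

  -- addresses are written in base 2n + 1, which exceeds every digit
  base : ℕ
  base = suc (2 * n)

  -- the digit of x is n + 1 + 2·rank - (number of siblings): distinct among siblings,
  -- smaller than 2n + 1, and summing to 2n for mirror siblings
  digit : Fin n → ℕ
  digit x = (suc n + 2 * siblingRank x) ∸ siblingCount x

  digit-spec : ∀ {x} → x ≢ v → digit x + siblingCount x ≡ suc n + 2 * siblingRank x
  digit-spec {x} x≢v = m∸n+n≡m (≤-trans (children-length _) (≤-trans (n≤1+n n) (m≤m+n (suc n) _)))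

  digit-< : ∀ {x} → x ≢ v → digit x < base
  digit-< {x} x≢v =
    s≤s (≤-trans digit≤n+r (≤-trans (+-monoʳ-≤ n r≤n) (≤-reflexive (cong (n +_) (sym (+-identityʳ n))))))
    where
    r = siblingRank x
    r<k = siblingRank-< x≢v
    r≤n : r ≤ n
    r≤n = <⇒≤ (≤-trans r<k (children-length _))
    regroup : ∀ n r → suc n + 2 * r ≡ (n + r) + suc r
    regroup = solve-∀
    digit≤n+r : digit x ≤ n + r
    digit≤n+r = +-cancelʳ-≤ (suc r) (digit x) (n + r)
      (≤-trans (+-monoʳ-≤ (digit x) r<k) (≤-reflexive (trans (digit-spec x≢v) (regroup n r))))

  digit-pair : ∀ {x} → x ≢ v → digit x + digit (mirrorSibling x) ≡ 2 * n
  digit-pair {x} x≢v = +-cancelʳ-≡ (2 * k) _ _ (begin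
    (digit x + digit y) + 2 * k                                ≡⟨ spread (digit x) (digit y) k ⟩
    (digit x + k) + (digit y + k)                              ≡⟨ cong₂ _+_ (digit-spec x≢v) digit-spec-y ⟩
    (suc n + 2 * siblingRank x) + (suc n + 2 * siblingRank y)  ≡⟨ collect n (siblingRank x) (siblingRank y) ⟩
    2 * n + 2 * suc (siblingRank x + siblingRank y)            ≡⟨ cong (λ m → 2 * n + 2 * m) (siblingRank-mirror x≢v) ⟩
    2 * n + 2 * k                                              ∎)
    where
    open ≡-Reasoning
    y = mirrorSibling x
    k = siblingCount x
    y≢v = proj₁ (mirrorSibling-sibling x≢v)
    digit-spec-y : digit y + k ≡ suc n + 2 * siblingRank y
    digit-spec-y = trans (cong (digit y +_) (cong length (sym (siblings-of-mirror x≢v)))) (digit-spec y≢v)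
    spread : ∀ a b k → (a + b) + 2 * k ≡ (a + k) + (b + k)
    spread = solve-∀
    collect : ∀ n r s → (suc n + 2 * r) + (suc n + 2 * s) ≡ 2 * n + 2 * suc (r + s)
    collect = solve-∀

  digit-injective : ∀ {x y} → x ≢ v → y ≢ v → parent x ≡ parent y → digit x ≡ digit y → x ≡ y
  digit-injective {x} {y} x≢v y≢v px≡py dx≡dy = siblingRank-injective x≢v y≢v px≡py
    (*-cancelˡ-≡ _ _ 2 (+-cancelˡ-≡ (suc n) _ _ (begin
      suc n + 2 * siblingRank x  ≡⟨ sym (digit-spec x≢v) ⟩
      digit x + siblingCount x   ≡⟨ cong₂ _+_ dx≡dy (cong (length ∘ children) px≡py) ⟩
      digit y + siblingCount y   ≡⟨ digit-spec y≢v ⟩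
      suc n + 2 * siblingRank y  ∎)))
    where open ≡-Reasoning

  addressAt : ℕ → Fin n → ℕ
  addressAt zero    x = 0
  addressAt (suc t) x = digit x + addressAt t (parent x) * base

  address : Fin n → ℕ
  address x = addressAt (depth x) x

  address-step : ∀ {x} → x ≢ v → address x ≡ digit x + address (parent x) * base
  address-step {x} x≢v rewrite depth-parent x≢v = refl

  address-injective : ∀ t {x y} → depth x ≡ t → depth y ≡ t → address x ≡ address y → x ≡ y
  address-injective zero dx≡0 dy≡0 _ = trans (root-of-depth-zero dx≡0) (sym (root-of-depth-zero dy≡0))
  address-injective (suc t) {x} {y} dx≡t+1 dy≡t+1 ax≡ay =
    digit-injective x≢v y≢v parents-equal digits-equal
    where
    x≢v = nonroot-of-depth-suc dx≡t+1
    y≢v = nonroot-of-depth-suc dy≡t+1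
    split = base-digits-unique base (digit-< x≢v) (digit-< y≢v)
              (trans (sym (address-step x≢v)) (trans ax≡ay (address-step y≢v)))
    digits-equal = proj₁ split
    parents-equal : parent x ≡ parent y
    parents-equal = address-injective t
      (suc-injective (trans (sym (depth-parent x≢v)) dx≡t+1))
      (suc-injective (trans (sym (depth-parent y≢v)) dy≡t+1))
      (proj₂ split)

  open ScaledOdd (2 * n) using (K; scaled-odd-nonzero; scaled-odd-injective; power-suc)

  maxDepth : ℕ
  maxDepth = depth (argmax depth v (allFin n))

  depth-≤-max : ∀ x → depth x ≤ maxDepth
  depth-≤-max x = All.lookup (f[xs]≤f[argmax] {f = depth} v (allFin n)) (∈-allFin x)

  scaledOdd : ℕ → ℕ → ℕ
  scaledOdd zero    _ = 0
  scaledOdd (suc t) a = K ^ (maxDepth ∸ suc t) * suc (2 * a)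

  label : Fin n → ℕ
  label x = scaledOdd (depth x) (address x)

  label-root : label v ≡ 0
  label-root rewrite depth-root = refl

  label-nonroot : ∀ {x} → x ≢ v → label x ≡ K ^ (maxDepth ∸ depth x) * suc (2 * address x)
  label-nonroot x≢v rewrite depth-parent x≢v = refl

  -- the exponent recovers the depth and the odd part the address
  label-injective : ∀ {x y} → label x ≡ label y → x ≡ y
  label-injective {x} {y} lx≡ly with x ≟ v | y ≟ v
  ... | yes x≡v | yes y≡v = trans x≡v (sym y≡v)
  ... | yes x≡v | no y≢v  = contradiction
    (trans (sym (label-nonroot y≢v)) (trans (sym lx≡ly) (trans (cong label x≡v) label-root)))
    (scaled-odd-nonzero (maxDepth ∸ depth y) (address y))
  ... | no x≢v  | yes y≡v = contradiction
    (trans (sym (label-nonroot x≢v)) (trans lx≡ly (trans (cong label y≡v) label-root)))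
    (scaled-odd-nonzero (maxDepth ∸ depth x) (address x))
  ... | no x≢v  | no y≢v
    with scaled-odd-injective (trans (sym (label-nonroot x≢v)) (trans lx≡ly (label-nonroot y≢v)))
  ...   | exponents-equal , addresses-equal = address-injective (depth x) refl
    (sym (∸-cancelˡ-≡ (depth-≤-max x) (depth-≤-max y) exponents-equal)) addresses-equal

  -- the key identity: an inner vertex is labelled by the sum of the labels of any child
  -- and its mirror sibling (their exponent is one less, their odd parts add up to K times it)
  label-parent : ∀ {x} → x ≢ v → parent x ≢ v → label (parent x) ≡ label x + label (mirrorSibling x)
  label-parent {x} x≢v px≢v = begin
    label u                                                     ≡⟨ label-nonroot px≢v ⟩
    K ^ (maxDepth ∸ depth u) * suc (2 * address u)              ≡⟨ cong (λ d → K ^ d * suc (2 * address u)) exponent ⟩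
    (K * K ^ e) * suc (2 * address u)                           ≡⟨ swap K (K ^ e) _ ⟩
    K ^ e * (K * suc (2 * address u))                           ≡⟨ cong (K ^ e *_) (sym odd-sum) ⟩
    K ^ e * (suc (2 * address x) + suc (2 * address y))         ≡⟨ *-distribˡ-+ (K ^ e) _ _ ⟩
    K ^ e * suc (2 * address x) + K ^ e * suc (2 * address y)   ≡⟨ cong₂ _+_ (sym (label-nonroot x≢v)) (sym label-y) ⟩
    label x + label y                                           ∎
    where
    open ≡-Reasoning
    u = parent x
    y = mirrorSibling x
    e = maxDepth ∸ depth x
    y≢v = proj₁ (mirrorSibling-sibling x≢v)
    py≡u = proj₂ (mirrorSibling-sibling x≢v)
    swap : ∀ a b c → (a * b) * c ≡ b * (a * c)
    swap = solve-∀
    exponent : maxDepth ∸ depth u ≡ suc e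
    exponent = trans (+-∸-assoc 1 (subst (_≤ maxDepth) (depth-parent x≢v) (depth-≤-max x)))
                     (cong (λ d → suc (maxDepth ∸ d)) (sym (depth-parent x≢v)))
    odd-sum : suc (2 * address x) + suc (2 * address y) ≡ K * suc (2 * address u)
    odd-sum = begin
      suc (2 * address x) + suc (2 * address y)
        ≡⟨ cong₂ (λ a b → suc (2 * a) + suc (2 * b)) (address-step x≢v)
                 (trans (address-step y≢v) (cong (λ w → digit y + address w * base) py≡u)) ⟩
      suc (2 * (digit x + address u * base)) + suc (2 * (digit y + address u * base))
        ≡⟨ odd-pair n (address u) (digit x) (digit y) (digit-pair x≢v) ⟩
      K * suc (2 * address u)  ∎
    label-y : label y ≡ K ^ e * suc (2 * address y)
    label-y = trans (label-nonroot y≢v) (cong (λ d → K ^ (maxDepth ∸ d) * suc (2 * address y))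
      (trans (depth-parent y≢v) (trans (cong (suc ∘ depth) py≡u) (sym (depth-parent x≢v)))))

  edgeLabel-parent : ∀ {x} → x ≢ v → edgeLabel label x (parent x) ≡ label (partner x)
  edgeLabel-parent {x} x≢v = by-parent (parent x ≟ v)
    where
    open ≡-Reasoning
    by-parent : Dec (parent x ≡ v) → edgeLabel label x (parent x) ≡ label (partner x)
    by-parent (yes px≡v) = begin
      ∣ label x - label (parent x) ∣  ≡⟨ cong (λ l → ∣ label x - l ∣) (trans (cong label px≡v) label-root) ⟩
      ∣ label x - 0 ∣                 ≡⟨ ∣-∣-identityʳ (label x) ⟩
      label x                         ≡⟨ cong label (sym (partner-of-root-child px≡v)) ⟩
      label (partner x)               ∎
    by-parent (no px≢v) = begin
      ∣ label x - label (parent x) ∣                   ≡⟨ cong (λ l → ∣ label x - l ∣) (label-parent x≢v px≢v) ⟩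
      ∣ label x - label x + label (mirrorSibling x) ∣  ≡⟨ ∣m-m+n∣≡n (label x) _ ⟩
      label (mirrorSibling x)                          ≡⟨ cong label (sym (partner-of-inner px≢v)) ⟩
      label (partner x)                                ∎

  IsParentEdgeOf : Fin n → Fin n → Fin n → Set
  IsParentEdgeOf z x y = z ≢ v × ((x ≡ z × y ≡ parent z) ⊎ (x ≡ parent z × y ≡ z))

  lower-endpoint : ∀ {x y} → Adj T x y → Σ (Fin n) λ z → IsParentEdgeOf z x y
  lower-endpoint {x} {y} x~y with edge-to-parent x~y
  ... | inj₁ (x≢v , px≡y) = x , x≢v , inj₁ (refl , sym px≡y)
  ... | inj₂ (y≢v , py≡x) = y , y≢v , inj₂ (sym py≡x , refl)

  edgeLabel-lower : ∀ {z x y} → IsParentEdgeOf z x y → edgeLabel label x y ≡ label (partner z)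
  edgeLabel-lower (z≢v , inj₁ (refl , refl)) = edgeLabel-parent z≢v
  edgeLabel-lower {z} (z≢v , inj₂ (refl , refl)) =
    trans (∣-∣-comm (label (parent z)) (label z)) (edgeLabel-parent z≢v)

  -- equal edge labels mean equal partners, hence equal lower endpoints, hence equal edges
  edge-labels-distinct : ∀ x y x′ y′ → Adj T x y → Adj T x′ y′ → edgeLabel label x y ≡ edgeLabel label x′ y′ →
                         (x ≡ x′ × y ≡ y′) ⊎ (x ≡ y′ × y ≡ x′)
  edge-labels-distinct x y x′ y′ x~y x′~y′ same-label with lower-endpoint x~y | lower-endpoint x′~y′
  ... | z , e@(z≢v , ends) | z′ , e′@(z′≢v , ends′)
    with partner-injective z≢v z′≢v
           (label-injective (trans (sym (edgeLabel-lower e)) (trans same-label (edgeLabel-lower e′))))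
  ... | refl with ends | ends′
  ...   | inj₁ (refl , refl) | inj₁ (refl , refl) = inj₁ (refl , refl)
  ...   | inj₁ (refl , refl) | inj₂ (refl , refl) = inj₂ (refl , refl)
  ...   | inj₂ (refl , refl) | inj₁ (refl , refl) = inj₂ (refl , refl)
  ...   | inj₂ (refl , refl) | inj₂ (refl , refl) = inj₁ (refl , refl)

  -- the label of a non-root x labels the edge from partner x to its parent
  vertex-labels-are-edge-labels : ∀ k → InVf label k → InEf T label k ⊎ k ≡ 0
  vertex-labels-are-edge-labels k (x , lx≡k) with x ≟ v
  ... | yes x≡v = inj₂ (trans (sym lx≡k) (trans (cong label x≡v) label-root))
  ... | no x≢v  = inj₁ (z , parent z , parent-adjacent z≢v ,
                       trans (edgeLabel-parent z≢v) (trans (cong label (partner-involutive x≢v)) lx≡k))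
    where
    z = partner x
    z≢v = proj₁ (partner-sibling x≢v)

  edge-labels-are-vertex-labels : ∀ k → InEf T label k ⊎ k ≡ 0 → InVf label k
  edge-labels-are-vertex-labels k (inj₁ (x , y , x~y , xy≡k)) with lower-endpoint x~y
  ... | z , e = partner z , trans (sym (edgeLabel-lower e)) xy≡k
  edge-labels-are-vertex-labels k (inj₂ refl) = v , label-root

  consistent : ConsistentRRG T label
  consistent = (label-injective , edge-labels-distinct)
             , vertex-labels-are-edge-labels , edge-labels-are-vertex-labels

every-vertex-labelling : ∀ {n} (T : Graph n) → IsTree T → (v : Fin n) →
  Σ (Fin n → ℕ) λ f → ConsistentRRG T f × f v ≡ 0
every-vertex-labelling T tree v = label , consistent , label-root
  where open Labelling T v (TreeRooting.rooting T tree v)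

mainTheorem10 : ∀ {n} (T : Graph n) → IsTree T → (v : Fin n) → IsLeaf T v →
    Σ (Fin n → ℕ) λ f → ConsistentRRG T f × f v ≡ 0
mainTheorem10 T tree v _ = every-vertex-labelling T tree v
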